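{- Let $\mathbb{F}_q$ be a finite field of odd characteristic and $c\in\mathbb{F}_q$. There is a packing of three pairwise disjoint circles of radius $c$ in $\mathbb{F}_q^2$ whose centers form a triangle with nonzero sidelengths $\ell_1,\ell_2,\ell_3$ if and only if $\ell_1(4c-\ell_1)$, $\ell_2(4c-\ell_2)$, $\ell_3(4c-\ell_3)$ are nonsquares in $\mathbb{F}_q$ and $4\sigma_2-\sigma_1^2$ is a square in $\mathbb{F}_q$, where $\sigma_1=\ell_1+\ell_2+\ell_3$ and $\sigma_2=\ell_1\ell_2+\ell_2\ell_3+\ell_3\ell_1$.
   Context: For $v=(v_1,v_2)\in\mathbb{F}_q^2$, $\|v\|=v_1^2+v_2^2$; the sidelengths of a triangle with vertices $x_1,x_2,x_3$ are $\|x_1-x_2\|,\|x_2-x_3\|,\|x_3-x_1\|$. The circle of radius $R$ and center $u$ is $\{x\in\mathbb{F}_q^2:\|x-u\|=R\}$. An element $s$ is a square in $\mathbb{F}_q$ if $s=y^2$ for some $y\in\mathbb{F}_q$. -}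

module Defs where

open import Level using (Level; _⊔_) renaming (suc to lsuc)
open import Algebra.Bundles using (CommutativeRing)
open import Data.Nat using (ℕ)
open import Data.Fin using (Fin)
open import Data.Product using (Σ; ∃; _×_; _,_)
open import Relation.Nullary using (¬_)
open import Relation.Binary.Definitions using (Decidable)

record FiniteField (c ℓ : Level) : Set (lsuc (c ⊔ ℓ)) where
  field
    ring : CommutativeRing c ℓ
  open CommutativeRing ring
  field
    1≉0       : ¬ (1# ≈ 0#)
    inverse   : ∀ x → ¬ (x ≈ 0#) → ∃ λ y → x * y ≈ 1#
    _≟_       : Decidable _≈_
    size      : ℕ
    enum      : Fin size → Carrier
    enum-surj : ∀ x → ∃ λ i → enum i ≈ x

module Geometry {c ℓ : Level} (R : CommutativeRing c ℓ) where
  open CommutativeRing R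

  two four : Carrier
  two  = 1# + 1#
  four = two + two

  Point : Set c
  Point = Carrier × Carrier

  _⊖_ : Point → Point → Point
  (x₁ , x₂) ⊖ (y₁ , y₂) = (x₁ - y₁ , x₂ - y₂)

  ‖_‖ : Point → Carrier
  ‖ (v₁ , v₂) ‖ = v₁ * v₁ + v₂ * v₂

  IsSquare : Carrier → Set (c ⊔ ℓ)
  IsSquare s = ∃ λ y → y * y ≈ s

  OnCircle : Point → Carrier → Point → Set ℓ
  OnCircle u r x = ‖ x ⊖ u ‖ ≈ r

  DisjointCircles : Carrier → Point → Point → Set (c ⊔ ℓ)
  DisjointCircles r u v = ∀ x → ¬ (OnCircle u r x × OnCircle v r x)

  CirclePacking : Carrier → Carrier → Carrier → Carrier → Set (c ⊔ ℓ)
  CirclePacking r l₁ l₂ l₃ =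
    Σ Point λ u₁ → Σ Point λ u₂ → Σ Point λ u₃ →
      (‖ u₁ ⊖ u₂ ‖ ≈ l₁) × (‖ u₂ ⊖ u₃ ‖ ≈ l₂) × (‖ u₃ ⊖ u₁ ‖ ≈ l₃) ×
      DisjointCircles r u₁ u₂ × DisjointCircles r u₂ u₃ × DisjointCircles r u₃ u₁

  σ₁ σ₂ : Carrier → Carrier → Carrier → Carrier
  σ₁ l₁ l₂ l₃ = l₁ + l₂ + l₃
  σ₂ l₁ l₂ l₃ = l₁ * l₂ + l₂ * l₃ + l₃ * l₁

  PackingCondition : Carrier → Carrier → Carrier → Carrier → Set (c ⊔ ℓ)
  PackingCondition r l₁ l₂ l₃ =
    ¬ IsSquare (l₁ * (four * r - l₁)) ×
    ¬ IsSquare (l₂ * (four * r - l₂)) ×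
    ¬ IsSquare (l₃ * (four * r - l₃)) ×
    IsSquare (four * σ₂ l₁ l₂ l₃ - σ₁ l₁ l₂ l₃ * σ₁ l₁ l₂ l₃)

-- Heron's formula, 16 · area² = 4σ₂ − σ₁² in the squared sidelengths, is a polynomial identity
-- in the coordinates, so the sidelengths of any triangle make 4σ₂ − σ₁² a square. Conversely, when
-- 2ℓ₁ is invertible, a square root of 4σ₂ − σ₁² determines a third vertex u₁ + t d + s d^⊥ over any
-- base d = u₂ − u₁ of squared length ℓ₁, and such a base exists because every element of a finite
-- field is a sum of two squares. Two circles of radius r whose centres are at squared distance ℓ
-- meet exactly at the apexes of triangles with squared sides ℓ, r, r, for which
-- 4σ₂ − σ₁² = ℓ(4r − ℓ); so the circles are disjoint iff ℓ(4r − ℓ) is a nonsquare.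

module Submission where

open import Algebra.Bundles using (CommutativeRing)
open import Data.Fin.Base using (Fin; fromℕ<) renaming (_≤_ to _≤ᶠ_; _<_ to _<ᶠ_)
import Data.Fin.Properties as Fin
open import Data.Integer.Base using (+_)
open import Data.Maybe.Base using (map)
open import Data.Nat.Base as ℕ using (ℕ; zero; suc)
import Data.Nat.Properties as ℕ
open import Data.Product.Base using (∃; ∃₂; _×_; _,_; proj₁; proj₂)
open import Data.Sum.Base using (_⊎_; inj₁; inj₂; [_,_]′)
open import Function.Base using (id)
open import Function.Bundles using (_⇔_; mk⇔)
open import Relation.Binary.Definitions using (tri<; tri≈; tri>)
open import Relation.Binary.PropositionalEquality.Core as ≡ using (_≡_)
open import Relation.Nullary.Decidable.Core using (Dec; yes; no; ¬?; dec⇒maybe; decidable-stable)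
open import Relation.Nullary.Negation.Core using (¬_; contradiction)

open import Defs

-- Integer coefficients, whose equality computes, let the ring solver work in any commutative ring.
module IntegerCoefficients {c ℓ} (R : CommutativeRing c ℓ) where
  open import Data.Integer.Base as ℤ using (ℤ; -[1+_]; _⊖_; _◃_; ∣_∣; sign)
  import Data.Integer.Properties as ℤ
  open import Data.Sign.Base as Sign using (Sign)
  open CommutativeRing R
  open import Algebra.Properties.AbelianGroup +-abelianGroup using (⁻¹-∙-comm)
  open import Algebra.Properties.CommutativeSemigroup +-commutativeSemigroup
    using (interchange)
  open import Algebra.Properties.CommutativeSemigroup *-commutativeSemigroup
    using () renaming (interchange to *-interchange)
  open import Algebra.Properties.Group +-group using (ε⁻¹≈ε; ⁻¹-involutive)
  open import Algebra.Properties.Ring ring using (-1*x≈-x)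
  open import Algebra.Properties.Semiring.Mult.TCOptimised semiring
    using (1+×; ×-homo-+; ×1-homo-*) renaming (_×_ to _×′_)
  open import Algebra.Solver.Ring.AlmostCommutativeRing
    using (fromCommutativeRing; _-Raw-AlmostCommutative⟶_)
  open import Relation.Binary.Reasoning.Setoid setoid

  -- The optimised multiple makes fromℤ (+ 1) and fromℤ (+ 2) reduce to 1# and 1# + 1#,
  -- so solver constants match the ring's own numerals definitionally.
  fromℕ : ℕ → Carrier
  fromℕ n = n ×′ 1#

  fromℤ : ℤ → Carrier
  fromℤ (+ n)      = fromℕ n
  fromℤ -[1+ n ]   = - fromℕ (suc n)

  fromSign : Sign → Carrier
  fromSign Sign.+ = 1#
  fromSign Sign.- = - 1#

  x-y≈[1+x]-[1+y] : ∀ x y → x - y ≈ (1# + x) - (1# + y)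
  x-y≈[1+x]-[1+y] x y = begin
    x - y                  ≈⟨ +-identityˡ (x - y) ⟨
    0# + (x - y)           ≈⟨ +-congʳ (-‿inverseʳ 1#) ⟨
    (1# - 1#) + (x - y)    ≈⟨ interchange 1# (- 1#) x (- y) ⟩
    (1# + x) + (- 1# - y)  ≈⟨ +-congˡ (⁻¹-∙-comm 1# y) ⟩
    (1# + x) - (1# + y)    ∎

  fromℤ-⊖ : ∀ m n → fromℤ (m ⊖ n) ≈ fromℕ m - fromℕ n
  fromℤ-⊖ m       zero    = sym (trans (+-congˡ ε⁻¹≈ε) (+-identityʳ _))
  fromℤ-⊖ zero    (suc n) = sym (+-identityˡ _)
  fromℤ-⊖ (suc m) (suc n) = begin
    fromℤ (suc m ⊖ suc n)                ≡⟨ ≡.cong fromℤ (ℤ.[1+m]⊖[1+n]≡m⊖n m n) ⟩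
    fromℤ (m ⊖ n)                        ≈⟨ fromℤ-⊖ m n ⟩
    fromℕ m - fromℕ n                    ≈⟨ x-y≈[1+x]-[1+y] _ _ ⟩
    (1# + fromℕ m) - (1# + fromℕ n)      ≈⟨ +-cong (1+× m 1#) (-‿cong (1+× n 1#)) ⟨
    fromℕ (suc m) - fromℕ (suc n)        ∎

  fromℤ-+ : ∀ i j → fromℤ (i ℤ.+ j) ≈ fromℤ i + fromℤ j
  fromℤ-+ -[1+ m ] -[1+ n ] = begin
    - fromℕ (suc (suc (m ℕ.+ n)))        ≡⟨ ≡.cong (λ k → - fromℕ (suc k)) (ℕ.+-suc m n) ⟨
    - fromℕ (suc m ℕ.+ suc n)            ≈⟨ -‿cong (×-homo-+ 1# (suc m) (suc n)) ⟩
    - (fromℕ (suc m) + fromℕ (suc n))    ≈⟨ ⁻¹-∙-comm _ _ ⟨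
    - fromℕ (suc m) - fromℕ (suc n)      ∎
  fromℤ-+ -[1+ m ] (+ n)    = trans (fromℤ-⊖ n (suc m)) (+-comm _ _)
  fromℤ-+ (+ m)    -[1+ n ] = fromℤ-⊖ m (suc n)
  fromℤ-+ (+ m)    (+ n)    = ×-homo-+ 1# m n

  fromℤ-◃ : ∀ s n → fromℤ (s ◃ n) ≈ fromSign s * fromℕ n
  fromℤ-◃ s      zero    = sym (zeroʳ _)
  fromℤ-◃ Sign.+ (suc n) = sym (*-identityˡ _)
  fromℤ-◃ Sign.- (suc n) = sym (-1*x≈-x _)

  fromSign-* : ∀ s t → fromSign (s Sign.* t) ≈ fromSign s * fromSign t
  fromSign-* Sign.- Sign.- = sym (trans (-1*x≈-x _) (⁻¹-involutive _))
  fromSign-* Sign.- Sign.+ = sym (*-identityʳ _)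
  fromSign-* Sign.+ _      = sym (*-identityˡ _)

  fromℤ-sign-abs : ∀ i → fromℤ i ≈ fromSign (sign i) * fromℕ ∣ i ∣
  fromℤ-sign-abs i = begin
    fromℤ i                    ≡⟨ ≡.cong fromℤ (ℤ.◃-inverse i) ⟨
    fromℤ (sign i ◃ ∣ i ∣)     ≈⟨ fromℤ-◃ (sign i) ∣ i ∣ ⟩
    fromSign (sign i) * fromℕ ∣ i ∣ ∎

  fromℤ-* : ∀ i j → fromℤ (i ℤ.* j) ≈ fromℤ i * fromℤ j
  fromℤ-* i j = begin
    fromℤ (sign i Sign.* sign j ◃ ∣ i ∣ ℕ.* ∣ j ∣)
      ≈⟨ fromℤ-◃ (sign i Sign.* sign j) (∣ i ∣ ℕ.* ∣ j ∣) ⟩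
    fromSign (sign i Sign.* sign j) * fromℕ (∣ i ∣ ℕ.* ∣ j ∣)
      ≈⟨ *-cong (fromSign-* (sign i) (sign j)) (×1-homo-* ∣ i ∣ ∣ j ∣) ⟩
    (fromSign (sign i) * fromSign (sign j)) * (fromℕ ∣ i ∣ * fromℕ ∣ j ∣)
      ≈⟨ *-interchange _ _ _ _ ⟩
    (fromSign (sign i) * fromℕ ∣ i ∣) * (fromSign (sign j) * fromℕ ∣ j ∣)
      ≈⟨ *-cong (fromℤ-sign-abs i) (fromℤ-sign-abs j) ⟨
    fromℤ i * fromℤ j
      ∎

  fromℤ-neg : ∀ i → fromℤ (ℤ.- i) ≈ - fromℤ i
  fromℤ-neg -[1+ n ]  = sym (⁻¹-involutive _)
  fromℤ-neg (+ zero)  = sym ε⁻¹≈ε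
  fromℤ-neg (+ suc n) = refl

  fromℤ-homomorphism : ℤ.+-*-rawRing -Raw-AlmostCommutative⟶ fromCommutativeRing R
  fromℤ-homomorphism = record
    { ⟦_⟧    = fromℤ
    ; +-homo = fromℤ-+
    ; *-homo = fromℤ-*
    ; -‿homo = fromℤ-neg
    ; 0-homo = refl
    ; 1-homo = refl
    }

  open import Algebra.Solver.Ring ℤ.+-*-rawRing (fromCommutativeRing R) fromℤ-homomorphism
    (λ i j → map (λ i≡j → reflexive (≡.cong fromℤ i≡j)) (dec⇒maybe (i ℤ.≟ j)))
    public
    using (Polynomial; solve; _:=_; con; _:+_; _:*_; _:-_)

module PlaneGeometry {c ℓ} (R : CommutativeRing c ℓ) where
  open CommutativeRing R
  open Geometry R
  open IntegerCoefficients R using (Polynomial; solve; _:=_; con; _:+_; _:*_; _:-_)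
  open import Relation.Binary.Reasoning.Setoid setoid

  private
    twoₚ fourₚ : ∀ {n} → Polynomial n
    twoₚ  = con (+ 2)
    fourₚ = twoₚ :+ twoₚ

    ‖_⊖_‖ₚ : ∀ {n} → Polynomial n × Polynomial n → Polynomial n × Polynomial n → Polynomial n
    ‖ (x₁ , x₂) ⊖ (y₁ , y₂) ‖ₚ = (x₁ :- y₁) :* (x₁ :- y₁) :+ (x₂ :- y₂) :* (x₂ :- y₂)

    heronₚ : ∀ {n} → Polynomial n → Polynomial n → Polynomial n → Polynomial n
    heronₚ l₁ l₂ l₃ =
      fourₚ :* (l₁ :* l₂ :+ l₂ :* l₃ :+ l₃ :* l₁) :- (l₁ :+ l₂ :+ l₃) :* (l₁ :+ l₂ :+ l₃)

    apexₚ : ∀ {n} → Polynomial n → Polynomial n →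
            Polynomial n × Polynomial n → Polynomial n × Polynomial n → Polynomial n × Polynomial n
    apexₚ t s (a₁ , a₂) (b₁ , b₂) =
      a₁ :+ t :* (b₁ :- a₁) :- s :* (b₂ :- a₂) , a₂ :+ t :* (b₂ :- a₂) :+ s :* (b₁ :- a₁)

  IsSquare-resp : ∀ {x y} → x ≈ y → IsSquare x → IsSquare y
  IsSquare-resp x≈y (s , s²≈x) = s , trans s²≈x x≈y

  ‖⊖‖-comm : ∀ u v → ‖ u ⊖ v ‖ ≈ ‖ v ⊖ u ‖
  ‖⊖‖-comm (u₁ , u₂) (v₁ , v₂) =
    solve 4 (λ u₁ u₂ v₁ v₂ → ‖ (u₁ , u₂) ⊖ (v₁ , v₂) ‖ₚ := ‖ (v₁ , v₂) ⊖ (u₁ , u₂) ‖ₚ)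
      refl u₁ u₂ v₁ v₂

  ‖⊖origin‖ : ∀ a b → ‖ (a , b) ⊖ (0# , 0#) ‖ ≈ a * a + b * b
  ‖⊖origin‖ = solve 2 (λ a b → ‖ (a , b) ⊖ (con (+ 0) , con (+ 0)) ‖ₚ := a :* a :+ b :* b) refl

  -- Heron's formula with the squared sidelengths l₁ l₂ l₃: 16 · area² = heron l₁ l₂ l₃.
  heron : Carrier → Carrier → Carrier → Carrier
  heron l₁ l₂ l₃ = four * σ₂ l₁ l₂ l₃ - σ₁ l₁ l₂ l₃ * σ₁ l₁ l₂ l₃

  heron-cong : ∀ {l₁ l₂ l₃ m₁ m₂ m₃} → l₁ ≈ m₁ → l₂ ≈ m₂ → l₃ ≈ m₃ →
               heron l₁ l₂ l₃ ≈ heron m₁ m₂ m₃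
  heron-cong {l₁} {l₂} {l₃} {m₁} {m₂} {m₃} e₁ e₂ e₃ =
    +-cong (*-congˡ σ₂-cong) (-‿cong (*-cong σ₁-cong σ₁-cong))
    where
    σ₁-cong : σ₁ l₁ l₂ l₃ ≈ σ₁ m₁ m₂ m₃
    σ₁-cong = +-cong (+-cong e₁ e₂) e₃
    σ₂-cong : σ₂ l₁ l₂ l₃ ≈ σ₂ m₁ m₂ m₃
    σ₂-cong = +-cong (+-cong (*-cong e₁ e₂) (*-cong e₂ e₃)) (*-cong e₃ e₁)

  heron-isosceles : ∀ l r → heron l r r ≈ l * (four * r - l)
  heron-isosceles =
    solve 2 (λ l r → heronₚ l r r := l :* (fourₚ :* r :- l)) refl

  wedge : Point → Point → Point → Carrier
  wedge (a₁ , a₂) (b₁ , b₂) (c₁ , c₂) = (b₁ - a₁) * (c₂ - a₂) - (b₂ - a₂) * (c₁ - a₁)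

  heron-identity : ∀ u₁ u₂ u₃ →
    two * wedge u₁ u₂ u₃ * (two * wedge u₁ u₂ u₃) ≈ heron ‖ u₁ ⊖ u₂ ‖ ‖ u₂ ⊖ u₃ ‖ ‖ u₃ ⊖ u₁ ‖
  heron-identity (a₁ , a₂) (b₁ , b₂) (c₁ , c₂) =
    solve 6 (λ a₁ a₂ b₁ b₂ c₁ c₂ →
      let w = (b₁ :- a₁) :* (c₂ :- a₂) :- (b₂ :- a₂) :* (c₁ :- a₁)
          a = (a₁ , a₂) ; b = (b₁ , b₂) ; c = (c₁ , c₂)
      in twoₚ :* w :* (twoₚ :* w) := heronₚ ‖ a ⊖ b ‖ₚ ‖ b ⊖ c ‖ₚ ‖ c ⊖ a ‖ₚ)
      refl a₁ a₂ b₁ b₂ c₁ c₂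

  sides⇒heron-square : ∀ {u₁ u₂ u₃ l₁ l₂ l₃} →
    ‖ u₁ ⊖ u₂ ‖ ≈ l₁ → ‖ u₂ ⊖ u₃ ‖ ≈ l₂ → ‖ u₃ ⊖ u₁ ‖ ≈ l₃ → IsSquare (heron l₁ l₂ l₃)
  sides⇒heron-square {u₁} {u₂} {u₃} e₁ e₂ e₃ =
    two * wedge u₁ u₂ u₃ , trans (heron-identity u₁ u₂ u₃) (heron-cong e₁ e₂ e₃)

  apex : Carrier → Carrier → Point → Point → Point
  apex t s (a₁ , a₂) (b₁ , b₂) =
    a₁ + t * (b₁ - a₁) - s * (b₂ - a₂) , a₂ + t * (b₂ - a₂) + s * (b₁ - a₁)

  ‖apex⊖u₁‖ : ∀ t s u₁ u₂ → ‖ apex t s u₁ u₂ ⊖ u₁ ‖ ≈ (t * t + s * s) * ‖ u₁ ⊖ u₂ ‖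
  ‖apex⊖u₁‖ t s (a₁ , a₂) (b₁ , b₂) =
    solve 6 (λ t s a₁ a₂ b₁ b₂ →
      let a = (a₁ , a₂) ; b = (b₁ , b₂)
      in ‖ apexₚ t s a b ⊖ a ‖ₚ := (t :* t :+ s :* s) :* ‖ a ⊖ b ‖ₚ)
      refl t s a₁ a₂ b₁ b₂

  ‖u₂⊖apex‖ : ∀ t s u₁ u₂ →
    ‖ u₂ ⊖ apex t s u₁ u₂ ‖ ≈ ‖ apex t s u₁ u₂ ⊖ u₁ ‖ + (1# - two * t) * ‖ u₁ ⊖ u₂ ‖
  ‖u₂⊖apex‖ t s (a₁ , a₂) (b₁ , b₂) =
    solve 6 (λ t s a₁ a₂ b₁ b₂ →
      let a = (a₁ , a₂) ; b = (b₁ , b₂) ; c = apexₚ t s a b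
      in ‖ b ⊖ c ‖ₚ := ‖ c ⊖ a ‖ₚ :+ (con (+ 1) :- twoₚ :* t) :* ‖ a ⊖ b ‖ₚ)
      refl t s a₁ a₂ b₁ b₂

  -- The converse of Heron's formula: the apex at parameters t = (l₁ + l₃ − l₂)/(2 l₁) and
  -- s = S/(2 l₁), where S² = heron l₁ l₂ l₃, has the prescribed distances to u₁ and u₂.
  third-vertex : ∀ {u₁ u₂ l₁ l₂ l₃} → (∃ λ k → two * l₁ * k ≈ 1#) →
    ‖ u₁ ⊖ u₂ ‖ ≈ l₁ → IsSquare (heron l₁ l₂ l₃) →
    ∃ λ u₃ → ‖ u₂ ⊖ u₃ ‖ ≈ l₂ × ‖ u₃ ⊖ u₁ ‖ ≈ l₃
  third-vertex {u₁} {u₂} {l₁} {l₂} {l₃} (k , 2l₁k≈1) side₁ (S , S²≈heron) =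
    apex t s u₁ u₂ , side₂ , side₃
    where
    e t s : Carrier
    e = l₁ + l₃ - l₂
    t = e * k
    s = S * k

    side₃ : ‖ apex t s u₁ u₂ ⊖ u₁ ‖ ≈ l₃
    side₃ = begin
      ‖ apex t s u₁ u₂ ⊖ u₁ ‖                  ≈⟨ ‖apex⊖u₁‖ t s u₁ u₂ ⟩
      (t * t + s * s) * ‖ u₁ ⊖ u₂ ‖            ≈⟨ *-congˡ side₁ ⟩
      (t * t + s * s) * l₁
        ≈⟨ solve 4 (λ e S k l₁ →
             (e :* k :* (e :* k) :+ S :* k :* (S :* k)) :* l₁ := (e :* e :+ S :* S) :* l₁ :* (k :* k))
             refl e S k l₁ ⟩
      (e * e + S * S) * l₁ * (k * k)           ≈⟨ *-congʳ (*-congʳ (+-congˡ S²≈heron)) ⟩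
      (e * e + heron l₁ l₂ l₃) * l₁ * (k * k)
        ≈⟨ solve 4 (λ k l₁ l₂ l₃ →
             let e = l₁ :+ l₃ :- l₂ in
             (e :* e :+ heronₚ l₁ l₂ l₃) :* l₁ :* (k :* k)
               := twoₚ :* l₁ :* k :* (twoₚ :* l₁ :* k :* l₃))
             refl k l₁ l₂ l₃ ⟩
      two * l₁ * k * (two * l₁ * k * l₃)       ≈⟨ *-cong 2l₁k≈1 (*-congʳ 2l₁k≈1) ⟩
      1# * (1# * l₃)                           ≈⟨ trans (*-identityˡ _) (*-identityˡ l₃) ⟩
      l₃                                       ∎

    side₂ : ‖ u₂ ⊖ apex t s u₁ u₂ ‖ ≈ l₂
    side₂ = begin
      ‖ u₂ ⊖ apex t s u₁ u₂ ‖                             ≈⟨ ‖u₂⊖apex‖ t s u₁ u₂ ⟩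
      ‖ apex t s u₁ u₂ ⊖ u₁ ‖ + (1# - two * t) * ‖ u₁ ⊖ u₂ ‖  ≈⟨ +-cong side₃ (*-congˡ side₁) ⟩
      l₃ + (1# - two * t) * l₁
        ≈⟨ solve 4 (λ e k l₁ l₃ →
             l₃ :+ (con (+ 1) :- twoₚ :* (e :* k)) :* l₁ := l₁ :+ l₃ :- e :* (twoₚ :* l₁ :* k))
             refl e k l₁ l₃ ⟩
      l₁ + l₃ - e * (two * l₁ * k)                        ≈⟨ +-congˡ (-‿cong (*-congˡ 2l₁k≈1)) ⟩
      l₁ + l₃ - e * 1#
        ≈⟨ solve 3 (λ l₁ l₂ l₃ → l₁ :+ l₃ :- (l₁ :+ l₃ :- l₂) :* con (+ 1) := l₂) refl l₁ l₂ l₃ ⟩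
      l₂                                                  ∎

  meeting-circles⇒square : ∀ {u v x l r} → ‖ u ⊖ v ‖ ≈ l →
    OnCircle u r x → OnCircle v r x → IsSquare (l * (four * r - l))
  meeting-circles⇒square {u} {v} {x} {l} {r} side x∈u x∈v =
    IsSquare-resp (heron-isosceles l r)
      (sides⇒heron-square side (trans (‖⊖‖-comm v x) x∈v) x∈u)

  nonsquare⇒disjoint : ∀ {u v l r} → ‖ u ⊖ v ‖ ≈ l →
    ¬ IsSquare (l * (four * r - l)) → DisjointCircles r u v
  nonsquare⇒disjoint side nonsquare x (x∈u , x∈v) =
    nonsquare (meeting-circles⇒square side x∈u x∈v)

  disjoint⇒nonsquare : ∀ {u v l r} → (∃ λ k → two * l * k ≈ 1#) → ‖ u ⊖ v ‖ ≈ l →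
    DisjointCircles r u v → ¬ IsSquare (l * (four * r - l))
  disjoint⇒nonsquare {u} {v} {l} {r} unit side disjoint square =
    let x , ‖v⊖x‖≈r , x∈u = third-vertex unit side (IsSquare-resp (sym (heron-isosceles l r)) square)
    in disjoint x (x∈u , trans (‖⊖‖-comm x v) ‖v⊖x‖≈r)

module FiniteFieldProperties {c ℓ} (F : FiniteField c ℓ) where
  open FiniteField F renaming (ring to R)
  open CommutativeRing R
  open IntegerCoefficients R using (solve; _:=_; con; _:+_; _:*_; _:-_)
  open import Algebra.Properties.Group +-group
    using ( ∙-cancelˡ; ⁻¹-injective; ⁻¹-involutive; ε⁻¹≈ε
          ; x≈y⇒x∙y⁻¹≈ε; x∙y⁻¹≈ε⇒x≈y; inverseˡ-unique)
  open import Relation.Binary.Reasoning.Setoid setoid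

  integral : ∀ {x y} → x * y ≈ 0# → x ≈ 0# ⊎ y ≈ 0#
  integral {x} {y} xy≈0 with x ≟ 0#
  ... | yes x≈0 = inj₁ x≈0
  ... | no x≉0  = let x⁻¹ , xx⁻¹≈1 = inverse x x≉0 in inj₂ (begin
    y               ≈⟨ *-identityˡ y ⟨
    1# * y          ≈⟨ *-congʳ xx⁻¹≈1 ⟨
    x * x⁻¹ * y     ≈⟨ solve 3 (λ x x⁻¹ y → x :* x⁻¹ :* y := x⁻¹ :* (x :* y)) refl x x⁻¹ y ⟩
    x⁻¹ * (x * y)   ≈⟨ *-congˡ xy≈0 ⟩
    x⁻¹ * 0#        ≈⟨ zeroʳ x⁻¹ ⟩
    0#              ∎)

  *-nonzero : ∀ {x y} → ¬ x ≈ 0# → ¬ y ≈ 0# → ¬ x * y ≈ 0#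
  *-nonzero x≉0 y≉0 xy≈0 with integral xy≈0
  ... | inj₁ x≈0 = x≉0 x≈0
  ... | inj₂ y≈0 = y≉0 y≈0

  x²≈0⇒x≈0 : ∀ {x} → x * x ≈ 0# → x ≈ 0#
  x²≈0⇒x≈0 x²≈0 with integral x²≈0
  ... | inj₁ x≈0 = x≈0
  ... | inj₂ x≈0 = x≈0

  x²≈y²⇒x≈±y : ∀ {x y} → x * x ≈ y * y → x ≈ y ⊎ x ≈ - y
  x²≈y²⇒x≈±y {x} {y} x²≈y² with integral (trans difference-of-squares (x≈y⇒x∙y⁻¹≈ε x²≈y²))
    where
    difference-of-squares : (x - y) * (x + y) ≈ x * x - y * y
    difference-of-squares = solve 2 (λ x y → (x :- y) :* (x :+ y) := x :* x :- y :* y) refl x y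
  ... | inj₁ x-y≈0 = inj₁ (x∙y⁻¹≈ε⇒x≈y x y x-y≈0)
  ... | inj₂ x+y≈0 = inj₂ (inverseˡ-unique x y x+y≈0)

  -- The index of the first occurrence of x in the enumeration depends only on the
  -- ≈-class of x, unlike the witness of enum-surj.
  first-occurrence : ∀ x → ∃ λ i → enum i ≈ x × (∀ {j} → j <ᶠ i → ¬ enum j ≈ x)
  first-occurrence x =
    let i , ¬¬hit , earlier-miss = Fin.¬∀⟶∃¬-smallest size (λ i → ¬ enum i ≈ x)
                                     (λ i → ¬? (enum i ≟ x)) (λ miss → miss _ (proj₂ (enum-surj x)))
    in i , decidable-stable (enum i ≟ x) ¬¬hit , λ {j} j<i →
         ≡.subst (λ j → ¬ enum j ≈ x)
           (Fin.toℕ-injective (≡.trans (Fin.toℕ-inject (fromℕ< j<i)) (Fin.toℕ-fromℕ< j<i)))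
           (earlier-miss (fromℕ< j<i))

  index : Carrier → Fin size
  index x = proj₁ (first-occurrence x)

  enum-index : ∀ x → enum (index x) ≈ x
  enum-index x = proj₁ (proj₂ (first-occurrence x))

  first-before : ∀ x {j} → j <ᶠ index x → ¬ enum j ≈ x
  first-before x = proj₂ (proj₂ (first-occurrence x))

  index-injective : ∀ {x y} → index x ≡ index y → x ≈ y
  index-injective {x} {y} eq =
    trans (sym (enum-index x)) (trans (reflexive (≡.cong enum eq)) (enum-index y))

  index-cong : ∀ {x y} → x ≈ y → index x ≡ index y
  index-cong {x} {y} x≈y with Fin.<-cmp (index x) (index y)
  ... | tri< i<j _ _ = contradiction (trans (enum-index x) x≈y) (first-before y i<j)
  ... | tri≈ _ i≡j _ = i≡j
  ... | tri> _ _ j<i = contradiction (trans (enum-index y) (sym x≈y)) (first-before x j<i)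

  module _ (f : Carrier → Carrier) (f-injective : ∀ {x y} → f x ≈ f y → x ≈ y) (a : Carrier) where
    orbit : ℕ → Carrier
    orbit zero    = a
    orbit (suc n) = f (orbit n)

    orbit-injective : (∀ x → ¬ f x ≈ a) → ∀ {m n} → orbit m ≈ orbit n → m ≡ n
    orbit-injective a∉f {zero}  {zero}  _  = ≡.refl
    orbit-injective a∉f {zero}  {suc n} eq = contradiction (sym eq) (a∉f (orbit n))
    orbit-injective a∉f {suc m} {zero}  eq = contradiction eq (a∉f (orbit m))
    orbit-injective a∉f {suc m} {suc n} eq = ≡.cong suc (orbit-injective a∉f (f-injective eq))

    -- Pigeonhole: size + 1 points of an orbit avoiding a cannot be pairwise distinct.
    injective⇒¬¬surjective : ¬ ¬ (∃ λ x → f x ≈ a)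
    injective⇒¬¬surjective a∉f = Fin.<⇒notInjective (ℕ.n<1+n size)
      (λ eq → Fin.toℕ-injective (orbit-injective (λ x fx≈a → a∉f (x , fx≈a)) (index-injective eq)))

  -- Selects one element from each pair {x, −x}.
  Positive : Carrier → Set
  Positive x = index x ≤ᶠ index (- x)

  positive? : ∀ x → Dec (Positive x)
  positive? x = index x Fin.≤? index (- x)

  x≈-y⇒-x≈y : ∀ {x y} → x ≈ - y → - x ≈ y
  x≈-y⇒-x≈y {x} {y} x≈-y = trans (-‿cong x≈-y) (⁻¹-involutive y)

  positive-≈-neg⇒≈ : ∀ {x y} → Positive x → Positive y → x ≈ - y → x ≈ y
  positive-≈-neg⇒≈ {x} {y} x⁺ y⁺ x≈-y = index-injective (Fin.≤-antisym
    (≡.subst (index x ≤ᶠ_) (index-cong (x≈-y⇒-x≈y x≈-y)) x⁺)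
    (≡.subst (index y ≤ᶠ_) (index-cong (sym x≈-y)) y⁺))

  negative-≉-neg : ∀ {x y} → ¬ Positive x → ¬ Positive y → ¬ x ≈ - y
  negative-≉-neg {x} {y} x⁻ y⁻ x≈-y = Fin.<-asym
    (≡.subst (_<ᶠ index x) (index-cong (x≈-y⇒-x≈y x≈-y)) (ℕ.≰⇒> x⁻))
    (≡.subst (_<ᶠ index y) (index-cong (sym x≈-y)) (ℕ.≰⇒> y⁻))

  -- If l were not a sum of two squares, x ↦ x² on positive x and x ↦ l − x² otherwise
  -- would be an injective map avoiding l.
  sum-of-two-squares : ∀ l → ∃₂ λ a b → a * a + b * b ≈ l
  sum-of-two-squares l
    with Fin.any? (λ i → Fin.any? (λ j → (enum i * enum i + enum j * enum j) ≟ l))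
  ... | yes (i , j , sum≈l) = enum i , enum j , sum≈l
  ... | no none = contradiction g-avoids-l g-hits-l
    where
    not-sum : ∀ a b → ¬ a * a + b * b ≈ l
    not-sum a b sum≈l = none (index a , index b ,
      trans (+-cong (*-cong (enum-index a) (enum-index a)) (*-cong (enum-index b) (enum-index b))) sum≈l)

    select : ∀ x → Dec (Positive x) → Carrier
    select x (yes _) = x * x
    select x (no _)  = l - x * x

    g : Carrier → Carrier
    g x = select x (positive? x)

    add-back : ∀ {x y} → x ≈ l - y → x + y ≈ l
    add-back {x} {y} x≈l-y = trans (+-congʳ x≈l-y) (solve 2 (λ l y → l :- y :+ y := l) refl l y)

    cancel : ∀ {x y} → l - x ≈ l - y → x ≈ y
    cancel l-x≈l-y = ⁻¹-injective (∙-cancelˡ l _ _ l-x≈l-y)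

    g-injective : ∀ {x y} → g x ≈ g y → x ≈ y
    g-injective {x} {y} gx≈gy with positive? x | positive? y
    ... | yes x⁺ | yes y⁺ = [ id , positive-≈-neg⇒≈ x⁺ y⁺ ]′ (x²≈y²⇒x≈±y gx≈gy)
    ... | yes _  | no _   = contradiction (add-back gx≈gy) (not-sum x y)
    ... | no _   | yes _  = contradiction (add-back (sym gx≈gy)) (not-sum y x)
    ... | no x⁻  | no y⁻  =
      [ id , (λ x≈-y → contradiction x≈-y (negative-≉-neg x⁻ y⁻)) ]′ (x²≈y²⇒x≈±y (cancel gx≈gy))

    g-avoids-l : ¬ (∃ λ x → g x ≈ l)
    g-avoids-l (x , gx≈l) with positive? x
    ... | yes _ =
      not-sum x 0# (trans (solve 1 (λ x → x :* x :+ con (+ 0) :* con (+ 0) := x :* x) refl x) gx≈l)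
    ... | no x⁻ = negative-≉-neg x⁻ x⁻ (trans x≈0 (sym (trans (-‿cong x≈0) ε⁻¹≈ε)))
      where
      x≈0 : x ≈ 0#
      x≈0 = x²≈0⇒x≈0 (cancel (trans gx≈l (solve 1 (λ l → l := l :- con (+ 0)) refl l)))

    g-hits-l : ¬ ¬ (∃ λ x → g x ≈ l)
    g-hits-l = injective⇒¬¬surjective g g-injective l

mainTheorem8 : ∀ {c ℓ} (F : FiniteField c ℓ) →
    let R = FiniteField.ring F
        open CommutativeRing R
        open Geometry R
    in ¬ (two ≈ 0#) →
       ∀ (r l₁ l₂ l₃ : Carrier) →
       ¬ (l₁ ≈ 0#) → ¬ (l₂ ≈ 0#) → ¬ (l₃ ≈ 0#) →
       CirclePacking r l₁ l₂ l₃ ⇔ PackingCondition r l₁ l₂ l₃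
mainTheorem8 F two≉0 r l₁ l₂ l₃ l₁≉0 l₂≉0 l₃≉0 = mk⇔ packing⇒condition condition⇒packing
  where
  open FiniteField F using (inverse) renaming (ring to R)
  open CommutativeRing R
  open Geometry R
  open PlaneGeometry R
  open FiniteFieldProperties F

  two-l-unit : ∀ {l} → ¬ l ≈ 0# → ∃ λ k → two * l * k ≈ 1#
  two-l-unit l≉0 = inverse _ (*-nonzero two≉0 l≉0)

  packing⇒condition : CirclePacking r l₁ l₂ l₃ → PackingCondition r l₁ l₂ l₃
  packing⇒condition (u₁ , u₂ , u₃ , side₁ , side₂ , side₃ , disjoint₁₂ , disjoint₂₃ , disjoint₃₁) =
    disjoint⇒nonsquare (two-l-unit l₁≉0) side₁ disjoint₁₂ ,
    disjoint⇒nonsquare (two-l-unit l₂≉0) side₂ disjoint₂₃ ,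
    disjoint⇒nonsquare (two-l-unit l₃≉0) side₃ disjoint₃₁ ,
    sides⇒heron-square side₁ side₂ side₃

  condition⇒packing : PackingCondition r l₁ l₂ l₃ → CirclePacking r l₁ l₂ l₃
  condition⇒packing (nonsquare₁ , nonsquare₂ , nonsquare₃ , heron-square) =
    let a , b , a²+b²≈l₁ = sum-of-two-squares l₁
        side₁ = trans (‖⊖origin‖ a b) a²+b²≈l₁
        u₃ , side₂ , side₃ = third-vertex (two-l-unit l₁≉0) side₁ heron-square
    in (a , b) , (0# , 0#) , u₃ , side₁ , side₂ , side₃ ,
       nonsquare⇒disjoint side₁ nonsquare₁ ,
       nonsquare⇒disjoint side₂ nonsquare₂ ,
       nonsquare⇒disjoint side₃ nonsquare₃
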